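{- Let $k\ge 1$ be an integer, let $p<q$ be odd primes, let $n=2^kpq$, let $M=2^{k+1}-1$, and let $a=\sigma(n)-2n$. If $n$ is weird, then $a>M$, $M<p<2M$, $4\mid a$, and $M<a<M(M+1)$.
   Context: $\sigma(n)$ denotes the sum of all positive divisors of $n$. A natural number $n$ is abundant if $\sigma(n)>2n$. The aliquot parts of $n$ are the positive divisors $d$ of $n$ with $d<n$. An abundant number $n$ is pseudoperfect if $n$ equals the sum of the elements of some subset of the aliquot parts of $n$ (each aliquot part used at most once). A natural number $n$ is weird if it is abundant but not pseudoperfect. -}

module Defs where

open import Data.Nat using (ℕ; suc; _+_; _*_; _<_; _>_; _<?_)
open import Data.Nat.Divisibility using (_∣_; _∣?_)
open import Data.List using (List; filter; upTo)
open import Data.Nat.ListAction using (sum)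
open import Data.List.Relation.Binary.Sublist.Propositional using (_⊆_)
open import Data.Product using (∃; _×_)
open import Relation.Binary.PropositionalEquality using (_≡_)
open import Relation.Nullary using (¬_)

-- positive divisors of n, in increasing order (for n ≥ 1; for n = 0 this is [])
divisors : ℕ → List ℕ
divisors n = filter (λ d → d ∣? n) (filter (λ d → 0 <? d) (upTo (suc n)))

σ : ℕ → ℕ
σ n = sum (divisors n)

abundant : ℕ → Set
abundant n = σ n > 2 * n

aliquotParts : ℕ → List ℕ
aliquotParts n = filter (λ d → d <? n) (divisors n)

-- n is the sum of some subset of its aliquot parts (each used at most once):
-- a sublist of the duplicate-free list of aliquot parts
pseudoperfect : ℕ → Set
pseudoperfect n = abundant n × ∃ λ (S : List ℕ) → (S ⊆ aliquotParts n) × (sum S ≡ n)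

weird : ℕ → Set
weird n = abundant n × ¬ pseudoperfect n

module Submission where

-- Enumerating the divisors of n as the
-- products c·2^i (c ∈ {1, p, q, pq}, i ≤ k) gives σ(n) = M(1 + p)(1 + q), i.e.
-- the excess identity  a + pq = M(1 + p + q).  Any number below 2^(k+1) is a sum
-- of distinct powers 2^i with i ≤ k (binary expansion), so a number of the form
-- x₁·1 + x₂·p + x₃·q + x₄·pq with xⱼ < 2^(k+1) is a sum of distinct divisors
-- c·2^i of n, distinct because the odd part c and the exponent i of c·2^i are
-- determined by the number.  If a ≤ M then n = (M - a) + Mp + Mq + (2^k - 1)pq,
-- and if p ≤ M then n = pq + (2^k - 1)pq; both decompositions use only proper
-- divisors, so a weird n has a > M and p > M.  The remaining claims p < 2M,
-- 4 ∣ a and a < M(M + 1) are then arithmetic consequences of the excess identity.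

open import Defs
open import Data.Nat using (ℕ; zero; suc; NonZero; >-nonZero; >-nonZero⁻¹; nonTrivial⇒n>1; s≤s⁻¹;
  _+_; _*_; _∸_; _^_; _<_; _>_; _≤_; _≥_; z≤n; s≤s; _<?_; _≤?_; _≟_)
open import Data.Nat.Properties
open import Data.Nat.Divisibility
open import Data.Nat.Coprimality using (Coprime; coprime-divisor)
open import Data.Nat.Primality
  using (Prime; prime[2]; prime⇒irreducible; prime⇒nonZero; prime⇒nonTrivial; euclidsLemma)
open import Data.Nat.ListAction using (sum)
open import Data.Nat.ListAction.Properties using (sum-↭; sum-++)
open import Data.Nat.Tactic.RingSolver using (solve-∀)
open import Data.List using (List; []; _∷_; map; filter; upTo; downFrom; _++_)
open import Data.List.Membership.Propositional using (_∈_; _∉_)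
open import Data.List.Membership.Propositional.Properties
  using (∈-filter⁺; ∈-filter⁻; ∈-upTo⁺; ∈-downFrom⁺; ∈-map⁺; ∈-map⁻; ∈-++⁺ˡ; ∈-++⁺ʳ)
open import Data.List.Membership.Propositional.Properties.WithK using (unique∧set⇒bag)
open import Data.List.Membership.DecPropositional _≟_ using (_∈?_)
open import Data.List.Relation.Binary.BagAndSetEquality using (∼bag⇒↭)
open import Data.List.Relation.Binary.Disjoint.Propositional using (Disjoint)
open import Data.List.Relation.Binary.Sublist.Propositional using (_⊆_)
open import Data.List.Relation.Binary.Sublist.Propositional.Properties using (filter-⊆)
open import Data.List.Relation.Unary.All as All using (All; []; _∷_)
import Data.List.Relation.Unary.All.Properties as AllP
import Data.List.Relation.Unary.AllPairs as AllPairs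
open import Data.List.Relation.Unary.Any using (here; there)
open import Data.List.Relation.Unary.Linked using (Linked; []; [-]; _∷_)
open import Data.List.Relation.Unary.Linked.Properties using (Linked⇒AllPairs)
open import Data.List.Relation.Unary.Unique.Propositional using (Unique; []; _∷_)
import Data.List.Relation.Unary.Unique.Propositional.Properties as Unique
open import Data.Product using (∃; _×_; _,_; proj₁; proj₂)
open import Data.Sum using (inj₁; inj₂)
open import Function using (_∘_)
open import Function.Bundles using (mk⇔)
open import Relation.Binary.PropositionalEquality
open import Relation.Nullary using (¬_; yes; no; contradiction)

sum-sameMembers : {xs ys : List ℕ} → Unique xs → Unique ys →
                  (∀ {x} → x ∈ xs → x ∈ ys) → (∀ {x} → x ∈ ys → x ∈ xs) →
                  sum xs ≡ sum ys
sum-sameMembers xs! ys! to from = sum-↭ (∼bag⇒↭ (unique∧set⇒bag xs! ys! (mk⇔ to from)))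

divisor-positive : ∀ {d n} → 0 < n → d ∣ n → 0 < d
divisor-positive {zero} 0<n 0∣n = contradiction (0∣⇒≡0 0∣n) (>⇒≢ 0<n)
divisor-positive {suc d} _ _ = s≤s z≤n

divisors-unique : ∀ n → Unique (divisors n)
divisors-unique n = Unique.filter⁺ (_∣? n) (Unique.filter⁺ (0 <?_) (Unique.upTo⁺ (suc n)))

∈-divisors⁺ : ∀ {d n} → 0 < n → d ∣ n → d ∈ divisors n
∈-divisors⁺ {d} {n} 0<n d∣n =
  ∈-filter⁺ (_∣? n) (∈-filter⁺ (0 <?_) (∈-upTo⁺ (s≤s (∣⇒≤ {{>-nonZero 0<n}} d∣n)))
                                       (divisor-positive 0<n d∣n)) d∣n

∈-divisors⁻ : ∀ {d n} → d ∈ divisors n → d ∣ n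
∈-divisors⁻ {n = n} d∈ = proj₂ (∈-filter⁻ (_∣? n) {xs = filter (0 <?_) (upTo (suc n))} d∈)

σ-enumeration : ∀ {n} (D : List ℕ) → 0 < n → Unique D →
                (∀ {d} → d ∣ n → d ∈ D) → (∀ {d} → d ∈ D → d ∣ n) → σ n ≡ sum D
σ-enumeration {n} D 0<n D! complete sound =
  sum-sameMembers (divisors-unique n) D! (complete ∘ ∈-divisors⁻) (∈-divisors⁺ 0<n ∘ sound)

subsetSum-of-distinctParts : ∀ {n} (T : List ℕ) → Unique T → All (λ d → d ∣ n × d < n) T →
                             sum T ≡ n → ∃ λ S → S ⊆ aliquotParts n × sum S ≡ n
subsetSum-of-distinctParts {n} T T! parts sumT =
  S , filter-⊆ (_∈? T) (aliquotParts n) , trans (sum-sameMembers S! T! toT fromT) sumT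
  where
  S : List ℕ
  S = filter (_∈? T) (aliquotParts n)
  S! : Unique S
  S! = Unique.filter⁺ (_∈? T) (Unique.filter⁺ (_<? n) (divisors-unique n))
  toT : ∀ {d} → d ∈ S → d ∈ T
  toT d∈S = proj₂ (∈-filter⁻ (_∈? T) {xs = aliquotParts n} d∈S)
  fromT : ∀ {d} → d ∈ T → d ∈ S
  fromT d∈T with All.lookup parts d∈T
  ... | d∣n , d<n = ∈-filter⁺ (_∈? T)
                      (∈-filter⁺ (_<? n) (∈-divisors⁺ (≤-<-trans z≤n d<n) d∣n) d<n) d∈T

weight : List ℕ → ℕ
weight es = sum (map (2 ^_) es)

Below : ℕ → List ℕ → Set
Below K es = Unique es × All (_< K) es

below-cons : ∀ {K es} → Below K es → Below (suc K) (K ∷ es)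
below-cons (es! , es<K) =
  All.map (λ i<K K≡i → <⇒≢ i<K (sym K≡i)) es<K ∷ es! , ≤-refl ∷ All.map m≤n⇒m≤1+n es<K

below-weaken : ∀ {K es} → Below K es → Below (suc K) es
below-weaken (es! , es<K) = es! , All.map m≤n⇒m≤1+n es<K

downFrom-below : ∀ K → Below K (downFrom K)
downFrom-below zero = [] , []
downFrom-below (suc K) = below-cons (downFrom-below K)

weight-downFrom : ∀ K → weight (downFrom K) + 1 ≡ 2 ^ K
weight-downFrom zero = refl
weight-downFrom (suc K) = begin
  2 ^ K + weight (downFrom K) + 1   ≡⟨ +-assoc (2 ^ K) _ 1 ⟩
  2 ^ K + (weight (downFrom K) + 1) ≡⟨ cong (2 ^ K +_) (weight-downFrom K) ⟩
  2 ^ K + 2 ^ K                     ≡⟨ cong (2 ^ K +_) (+-identityʳ (2 ^ K)) ⟨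
  2 * 2 ^ K                         ∎
  where open ≡-Reasoning

bits : ℕ → ℕ → List ℕ
bits zero x = []
bits (suc K) x with 2 ^ K ≤? x
... | yes _ = K ∷ bits K (x ∸ 2 ^ K)
... | no _ = bits K x

bits-below : ∀ K x → Below K (bits K x)
bits-below zero x = [] , []
bits-below (suc K) x with 2 ^ K ≤? x
... | yes _ = below-cons (bits-below K (x ∸ 2 ^ K))
... | no _ = below-weaken (bits-below K x)

weight-bits : ∀ K x → x < 2 ^ K → weight (bits K x) ≡ x
weight-bits zero zero _ = refl
weight-bits zero (suc x) (s≤s ())
weight-bits (suc K) x x<2^K+1 with 2 ^ K ≤? x
... | yes 2^K≤x = begin
  2 ^ K + weight (bits K (x ∸ 2 ^ K)) ≡⟨ cong (2 ^ K +_) (weight-bits K (x ∸ 2 ^ K) rest<2^K) ⟩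
  2 ^ K + (x ∸ 2 ^ K)                 ≡⟨ m+[n∸m]≡n 2^K≤x ⟩
  x                                   ∎
  where
  open ≡-Reasoning
  rest<2^K : x ∸ 2 ^ K < 2 ^ K
  rest<2^K = +-cancelʳ-< (2 ^ K) (x ∸ 2 ^ K) (2 ^ K)
    (subst₂ _<_ (sym (m∸n+n≡m 2^K≤x)) (cong (2 ^ K +_) (+-identityʳ (2 ^ K))) x<2^K+1)
... | no 2^K≰x = weight-bits K x (≰⇒> 2^K≰x)

pow-∣ : ∀ {i k} → i ≤ k → 2 ^ i ∣ 2 ^ k
pow-∣ {k = k} z≤n = 1∣ (2 ^ k)
pow-∣ (s≤s i≤k) = *-monoʳ-∣ 2 (pow-∣ i≤k)

*2^-suc : ∀ c i → c * 2 ^ suc i ≡ 2 * (c * 2 ^ i)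
*2^-suc c i = begin
  c * (2 * 2 ^ i) ≡⟨ *-assoc c 2 (2 ^ i) ⟨
  c * 2 * 2 ^ i   ≡⟨ cong (_* 2 ^ i) (*-comm c 2) ⟩
  2 * c * 2 ^ i   ≡⟨ *-assoc 2 c (2 ^ i) ⟩
  2 * (c * 2 ^ i) ∎
  where open ≡-Reasoning

even : ∀ {x} y → x ≡ 2 * y → 2 ∣ x
even y x≡2y = divides y (trans x≡2y (*-comm 2 y))

odd⇒2∣suc : ∀ {x} → ¬ 2 ∣ x → 2 ∣ suc x
odd⇒2∣suc {zero} x-odd = contradiction (divides 0 refl) x-odd
odd⇒2∣suc {suc zero} _ = ∣-refl
odd⇒2∣suc {suc (suc x)} x+2-odd =
  ∣m∣n⇒∣m+n (∣-refl {2}) (odd⇒2∣suc (λ 2∣x → x+2-odd (∣m∣n⇒∣m+n (∣-refl {2}) 2∣x)))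

prime∤⇒coprime : ∀ {p x} → Prime p → ¬ p ∣ x → Coprime x p
prime∤⇒coprime p-prime p∤x (i∣x , i∣p) with prime⇒irreducible p-prime i∣p
... | inj₁ i≡1 = i≡1
... | inj₂ refl = contradiction i∣x p∤x

oddPart-unique : ∀ {c c'} i j → ¬ 2 ∣ c → ¬ 2 ∣ c' → c * 2 ^ i ≡ c' * 2 ^ j → c ≡ c' × i ≡ j
oddPart-unique {c} {c'} zero zero _ _ eq = *-cancelʳ-≡ c c' 1 eq , refl
oddPart-unique {c} {c'} zero (suc j) c-odd _ eq =
  contradiction (even (c' * 2 ^ j) (trans (sym (*-identityʳ c)) (trans eq (*2^-suc c' j)))) c-odd
oddPart-unique {c} {c'} (suc i) zero _ c'-odd eq =
  contradiction (even (c * 2 ^ i) (trans (sym (*-identityʳ c')) (trans (sym eq) (*2^-suc c i)))) c'-odd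
oddPart-unique {c} {c'} (suc i) (suc j) c-odd c'-odd eq
  with oddPart-unique i j c-odd c'-odd
         (*-cancelˡ-≡ _ _ 2 (trans (sym (*2^-suc c i)) (trans eq (*2^-suc c' j))))
... | c≡c' , i≡j = c≡c' , cong suc i≡j

divisor-timesPower : ∀ k {m d} → d ∣ m * 2 ^ k → ∃ λ e → ∃ λ i → e ∣ m × i ≤ k × d ≡ e * 2 ^ i
divisor-timesPower zero {m} {d} d∣m =
  d , 0 , subst (d ∣_) (*-identityʳ m) d∣m , z≤n , sym (*-identityʳ d)
divisor-timesPower (suc k) {m} {d} d∣m2^k+1 with 2 ∣? d | subst (d ∣_) (*2^-suc m k) d∣m2^k+1
... | yes (divides w refl) | w2∣2m2^k
  with divisor-timesPower k {m} {w} (*-cancelˡ-∣ 2 (subst (_∣ 2 * (m * 2 ^ k)) (*-comm w 2) w2∣2m2^k))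
... | e , i , e∣m , i≤k , w≡e2^i =
  e , suc i , e∣m , s≤s i≤k , trans (*-comm w 2) (trans (cong (2 *_) w≡e2^i) (sym (*2^-suc e i)))
divisor-timesPower (suc k) {m} {d} _ | no d-odd | d∣2m2^k
  with divisor-timesPower k (coprime-divisor (prime∤⇒coprime prime[2] d-odd) d∣2m2^k)
... | e , i , e∣m , i≤k , d≡e2^i = e , i , e∣m , m≤n⇒m≤1+n i≤k , d≡e2^i

primeProduct-divisor : ∀ {p q e} → Prime p → Prime q → e ∣ p * q → e ∈ 1 ∷ p ∷ q ∷ p * q ∷ []
primeProduct-divisor {p} {q} {e} p-prime q-prime e∣pq with p ∣? e
... | yes (divides f refl)
  with prime⇒irreducible q-prime (*-cancelˡ-∣ p {{prime⇒nonZero p-prime}} (subst (_∣ p * q) (*-comm f p) e∣pq))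
...   | inj₁ refl = there (here (*-identityˡ p))
...   | inj₂ refl = there (there (there (here (*-comm q p))))
primeProduct-divisor {p} {q} {e} p-prime q-prime e∣pq | no p∤e
  with prime⇒irreducible q-prime (coprime-divisor (prime∤⇒coprime p-prime p∤e) e∣pq)
...   | inj₁ refl = here refl
...   | inj₂ refl = there (there (here refl))

-- A block (c , es) stands for the numbers c·2^i, i ∈ es; a list of blocks
-- with distinct odd multipliers c describes a set of distinct numbers.
Block : Set
Block = ℕ × List ℕ

multiples : ℕ → List ℕ → List ℕ
multiples c es = map (λ i → c * 2 ^ i) es

assemble : List Block → List ℕ
assemble [] = []
assemble ((c , es) ∷ bs) = multiples c es ++ assemble bs

blockValue : Block → ℕ
blockValue (c , es) = c * weight es

sum-multiples : ∀ c es → sum (multiples c es) ≡ c * weight es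
sum-multiples c [] = sym (*-zeroʳ c)
sum-multiples c (i ∷ es) = begin
  c * 2 ^ i + sum (multiples c es) ≡⟨ cong (c * 2 ^ i +_) (sum-multiples c es) ⟩
  c * 2 ^ i + c * weight es        ≡⟨ *-distribˡ-+ c (2 ^ i) (weight es) ⟨
  c * (2 ^ i + weight es)          ∎
  where open ≡-Reasoning

sum-assemble : ∀ bs → sum (assemble bs) ≡ sum (map blockValue bs)
sum-assemble [] = refl
sum-assemble ((c , es) ∷ bs) = begin
  sum (multiples c es ++ assemble bs)       ≡⟨ sum-++ (multiples c es) (assemble bs) ⟩
  sum (multiples c es) + sum (assemble bs)  ≡⟨ cong₂ _+_ (sum-multiples c es) (sum-assemble bs) ⟩
  c * weight es + sum (map blockValue bs)   ∎
  where open ≡-Reasoning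

All-assemble : ∀ {P : ℕ → Set} bs →
               All (λ b → All (λ i → P (proj₁ b * 2 ^ i)) (proj₂ b)) bs → All P (assemble bs)
All-assemble [] [] = []
All-assemble ((c , es) ∷ bs) (Pes ∷ Pbs) = AllP.++⁺ (AllP.map⁺ Pes) (All-assemble bs Pbs)

∈-assemble⁺ : ∀ {c es i} bs → (c , es) ∈ bs → i ∈ es → c * 2 ^ i ∈ assemble bs
∈-assemble⁺ ((c , es) ∷ bs) (here refl) i∈es = ∈-++⁺ˡ (∈-map⁺ (λ i → c * 2 ^ i) i∈es)
∈-assemble⁺ ((c , es) ∷ bs) (there b∈bs) i∈es = ∈-++⁺ʳ (multiples c es) (∈-assemble⁺ bs b∈bs i∈es)

multiples-unique : ∀ {c es} → ¬ 2 ∣ c → Unique es → Unique (multiples c es)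
multiples-unique c-odd = Unique.map⁺ (λ eq → proj₂ (oddPart-unique _ _ c-odd c-odd eq))

-- Blocks with distinct odd multipliers and duplicate-free exponent lists
-- assemble to a duplicate-free list, by uniqueness of the odd part.
assemble-unique : ∀ bs → Unique (map proj₁ bs) → All (λ b → ¬ 2 ∣ proj₁ b) bs →
                  All (λ b → Unique (proj₂ b)) bs → Unique (assemble bs)
assemble-unique [] _ _ _ = []
assemble-unique ((c , es) ∷ bs) (c∉bs ∷ bs!) (c-odd ∷ bs-odd) (es! ∷ bs-es!) =
  Unique.++⁺ (multiples-unique c-odd es!) (assemble-unique bs bs! bs-odd bs-es!) disjoint
  where
  outside : All (_∉ multiples c es) (assemble bs)
  outside = All-assemble bs (All.zipWith outsideBlock (AllP.map⁻ c∉bs , bs-odd))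
    where
    outsideBlock : ∀ {b} → c ≢ proj₁ b × ¬ 2 ∣ proj₁ b → All (λ j → proj₁ b * 2 ^ j ∉ multiples c es) (proj₂ b)
    outsideBlock (c≢c' , c'-odd) = All.tabulate λ {j} _ x∈ →
      let (i , _ , eq) = ∈-map⁻ (λ i → c * 2 ^ i) x∈
      in c≢c' (sym (proj₁ (oddPart-unique j i c'-odd c-odd eq)))
  disjoint : Disjoint (multiples c es) (assemble bs)
  disjoint (x∈mult , x∈rest) = All.lookup outside x∈rest x∈mult

excess-identity : ∀ a M G p q → M + 1 ≡ 2 * G → a + 2 * (G * p * q) ≡ M * ((1 + p) * (1 + q)) →
                  a + p * q ≡ M * (1 + p + q)
excess-identity a M G p q M+1≡2G a+2n≡σ = +-cancelʳ-≡ (M * (p * q)) _ _ (begin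
  a + p * q + M * (p * q)     ≡⟨ regroup a M p q ⟩
  a + (M + 1) * (p * q)       ≡⟨ cong (λ x → a + x * (p * q)) M+1≡2G ⟩
  a + 2 * G * (p * q)         ≡⟨ cong (a +_) (reassoc G p q) ⟩
  a + 2 * (G * p * q)         ≡⟨ a+2n≡σ ⟩
  M * ((1 + p) * (1 + q))     ≡⟨ expand M p q ⟩
  M * (1 + p + q) + M * (p * q) ∎)
  where
  open ≡-Reasoning
  regroup : ∀ a M p q → a + p * q + M * (p * q) ≡ a + (M + 1) * (p * q)
  regroup = solve-∀
  reassoc : ∀ G p q → 2 * G * (p * q) ≡ 2 * (G * p * q)
  reassoc = solve-∀
  expand : ∀ M p q → M * ((1 + p) * (1 + q)) ≡ M * (1 + p + q) + M * (p * q)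
  expand = solve-∀

-- If the excess were at most M, n would be the sum
-- (M - a)·1 + M·p + M·q + (2^k - 1)·pq of multiples of its odd divisors.
fill-lowExcess : ∀ a M V p q → a ≤ M → a + p * q ≡ M * (1 + p + q) →
                 1 * (M ∸ a) + (p * M + (q * M + (p * q * V + 0))) ≡ (V + 1) * p * q
fill-lowExcess a M V p q a≤M key = +-cancelˡ-≡ a _ _ (begin
  a + (1 * (M ∸ a) + rest)    ≡⟨ cong (λ x → a + (x + rest)) (*-identityˡ (M ∸ a)) ⟩
  a + ((M ∸ a) + rest)        ≡⟨ +-assoc a (M ∸ a) rest ⟨
  a + (M ∸ a) + rest          ≡⟨ cong (_+ rest) (m+[n∸m]≡n a≤M) ⟩
  M + rest                    ≡⟨ regroup M V p q ⟩
  M * (1 + p + q) + p * q * V ≡⟨ cong (_+ p * q * V) key ⟨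
  a + p * q + p * q * V       ≡⟨ collect a V p q ⟩
  a + (V + 1) * p * q         ∎)
  where
  open ≡-Reasoning
  rest = p * M + (q * M + (p * q * V + 0))
  regroup : ∀ M V p q → M + (p * M + (q * M + (p * q * V + 0))) ≡ M * (1 + p + q) + p * q * V
  regroup = solve-∀
  collect : ∀ a V p q → a + p * q + p * q * V ≡ a + (V + 1) * p * q
  collect = solve-∀

-- If p were at most M, n would be the sum p·q + (2^k - 1)·pq.
fill-smallPrime : ∀ p q V → 1 * 0 + (p * 0 + (q * p + (p * q * V + 0))) ≡ (V + 1) * p * q
fill-smallPrime = solve-∀

large-product : ∀ M {p q} → 2 * M ≤ p → p < q → M * (1 + p + q) ≤ p * q
large-product M 2M≤p p<q with m≤n⇒∃[o]m+o≡n 2M≤p | m≤n⇒∃[o]m+o≡n p<q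
... | u , refl | v , refl = subst (M * (1 + (2 * M + u) + (suc (2 * M + u) + v)) ≤_) (sym (split M u v)) (m≤m+n _ _)
  where
  split : ∀ M u v → (2 * M + u) * (suc (2 * M + u) + v)
                    ≡ M * (1 + (2 * M + u) + (suc (2 * M + u) + v)) + (M * v + u * (suc (2 * M + u) + v))
  split = solve-∀

p<2M : ∀ a M {p q} → 0 < a → p < q → a + p * q ≡ M * (1 + p + q) → p < 2 * M
p<2M a M {p} {q} 0<a p<q key = ≰⇒> λ 2M≤p → n≮n (p * q) (begin-strict
  p * q           <⟨ +-monoˡ-< (p * q) 0<a ⟩
  a + p * q       ≡⟨ key ⟩
  M * (1 + p + q) ≤⟨ large-product M 2M≤p p<q ⟩
  p * q           ∎)
  where open ≤-Reasoning

-- For p, q > M: M(M + 1) + pq = M(1 + p + q) + (p - M)(q - M).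
a<M[M+1] : ∀ a M {p q} → M < p → M < q → a + p * q ≡ M * (1 + p + q) → a < M * (M + 1)
a<M[M+1] a M {p} {q} M<p M<q key with m≤n⇒∃[o]m+o≡n M<p | m≤n⇒∃[o]m+o≡n M<q
... | u , refl | v , refl = +-cancelʳ-< (p * q) a (M * (M + 1)) (begin-strict
  a + p * q                                 ≡⟨ key ⟩
  M * (1 + p + q)                           <⟨ m<m+n _ (s≤s z≤n) ⟩
  M * (1 + p + q) + suc u * suc v           ≡⟨ split M u v ⟩
  M * (M + 1) + p * q                       ∎)
  where
  open ≤-Reasoning
  split : ∀ M u v → M * (1 + (suc M + u) + (suc M + v)) + suc u * suc v
                    ≡ M * (M + 1) + (suc M + u) * (suc M + v)
  split = solve-∀

-- a + (1 + p)(1 + q) = (M + 1)(1 + p + q), and 4 divides both (1 + p)(1 + q)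
-- (p, q odd) and M + 1.
4∣a : ∀ a M {p q} → 4 ∣ M + 1 → ¬ 2 ∣ p → ¬ 2 ∣ q → a + p * q ≡ M * (1 + p + q) → 4 ∣ a
4∣a a M {p} {q} 4∣M+1 p-odd q-odd key = ∣m+n∣m⇒∣n 4∣sum 4∣[1+p][1+q]
  where
  open ≡-Reasoning
  4∣[1+p][1+q] : 4 ∣ (1 + p) * (1 + q)
  4∣[1+p][1+q] = *-pres-∣ (odd⇒2∣suc p-odd) (odd⇒2∣suc q-odd)
  sum≡ : (1 + p) * (1 + q) + a ≡ (M + 1) * (1 + p + q)
  sum≡ = begin
    (1 + p) * (1 + q) + a        ≡⟨ expand a p q ⟩
    a + p * q + (1 + p + q)      ≡⟨ cong (_+ (1 + p + q)) key ⟩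
    M * (1 + p + q) + (1 + p + q) ≡⟨ collect M p q ⟩
    (M + 1) * (1 + p + q)        ∎
    where
    expand : ∀ a p q → (1 + p) * (1 + q) + a ≡ a + p * q + (1 + p + q)
    expand = solve-∀
    collect : ∀ M p q → M * (1 + p + q) + (1 + p + q) ≡ (M + 1) * (1 + p + q)
    collect = solve-∀
  4∣sum : 4 ∣ (1 + p) * (1 + q) + a
  4∣sum = subst (4 ∣_) (sym sum≡) (∣m⇒∣m*n (1 + p + q) 4∣M+1)

module TwoPowerTimesPrimes (k : ℕ) {p q : ℕ} (p-prime : Prime p) (q-prime : Prime q)
                           (p-odd : ¬ 2 ∣ p) (q-odd : ¬ 2 ∣ q) (p<q : p < q) where

  instance
    p-nonZero : NonZero p
    p-nonZero = prime⇒nonZero p-prime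
    q-nonZero : NonZero q
    q-nonZero = prime⇒nonZero q-prime
    2^k-nonZero : NonZero (2 ^ k)
    2^k-nonZero = m^n≢0 2 k

  n : ℕ
  n = 2 ^ k * p * q

  exponents≤k : List ℕ
  exponents≤k = downFrom (suc k)

  exponents<k : List ℕ
  exponents<k = downFrom k

  n≡pq2^k : n ≡ p * q * 2 ^ k
  n≡pq2^k = trans (*-assoc (2 ^ k) p q) (*-comm (2 ^ k) (p * q))

  1<p : 1 < p
  1<p = nonTrivial⇒n>1 p {{prime⇒nonTrivial p-prime}}

  q<pq : q < p * q
  q<pq = subst (q <_) (*-comm q p) (m<m*n q p 1<p)

  p<pq : p < p * q
  p<pq = <-trans p<q q<pq

  oddDivisors-increasing : Linked _<_ (1 ∷ p ∷ q ∷ p * q ∷ [])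
  oddDivisors-increasing = 1<p ∷ p<q ∷ q<pq ∷ [-]

  pq-odd : ¬ 2 ∣ p * q
  pq-odd 2∣pq with euclidsLemma p q prime[2] 2∣pq
  ... | inj₁ 2∣p = p-odd 2∣p
  ... | inj₂ 2∣q = q-odd 2∣q

  blocks : (e₁ e₂ e₃ e₄ : List ℕ) → List Block
  blocks e₁ e₂ e₃ e₄ = (1 , e₁) ∷ (p , e₂) ∷ (q , e₃) ∷ (p * q , e₄) ∷ []

  blocks-unique : ∀ {e₁ e₂ e₃ e₄} → Unique e₁ → Unique e₂ → Unique e₃ → Unique e₄ →
                  Unique (assemble (blocks e₁ e₂ e₃ e₄))
  blocks-unique e₁! e₂! e₃! e₄! =
    assemble-unique (blocks _ _ _ _)
      (AllPairs.map (λ i<j → <⇒≢ i<j) (Linked⇒AllPairs <-trans oddDivisors-increasing))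
      ((λ 2∣1 → <⇒≱ (s≤s (s≤s z≤n)) (∣⇒≤ 2∣1)) ∷ p-odd ∷ q-odd ∷ pq-odd ∷ [])
      (e₁! ∷ e₂! ∷ e₃! ∷ e₄! ∷ [])

  oddPart-∣ : ∀ {c i} → c ∣ p * q → i ≤ k → c * 2 ^ i ∣ n
  oddPart-∣ {c} {i} c∣pq i≤k = subst (c * 2 ^ i ∣_) (sym n≡pq2^k) (*-pres-∣ c∣pq (pow-∣ i≤k))

  allDivisors : List ℕ
  allDivisors = assemble (blocks exponents≤k exponents≤k exponents≤k exponents≤k)

  allDivisors-complete : ∀ {d} → d ∣ n → d ∈ allDivisors
  allDivisors-complete {d} d∣n with divisor-timesPower k {p * q} (subst (d ∣_) n≡pq2^k d∣n)
  ... | c , i , c∣pq , i≤k , refl =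
    ∈-assemble⁺ (blocks exponents≤k exponents≤k exponents≤k exponents≤k)
                (∈-map⁺ (_, exponents≤k) (primeProduct-divisor p-prime q-prime c∣pq))
                (∈-downFrom⁺ (s≤s i≤k))

  allDivisors-sound : ∀ {d} → d ∈ allDivisors → d ∣ n
  allDivisors-sound = All.lookup (All-assemble {_∣ n} (blocks exponents≤k exponents≤k exponents≤k exponents≤k)
    (dividing (1∣ _) ∷ dividing (m∣m*n {p} q) ∷ dividing (n∣m*n p) ∷ dividing ∣-refl ∷ []))
    where
    dividing : ∀ {c} → c ∣ p * q → All (λ i → c * 2 ^ i ∣ n) exponents≤k
    dividing c∣pq = All.map (λ i<k+1 → oddPart-∣ c∣pq (s≤s⁻¹ i<k+1)) (proj₂ (downFrom-below (suc k)))

  M : ℕ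
  M = 2 ^ (k + 1) ∸ 1

  weight-allExponents : weight exponents≤k ≡ M
  weight-allExponents = trans (sym (m+n∸n≡m _ 1))
    (cong (_∸ 1) (trans (weight-downFrom (suc k)) (cong (2 ^_) (+-comm 1 k))))

  M+1≡2^[k+1] : M + 1 ≡ 2 ^ suc k
  M+1≡2^[k+1] = trans (cong (_+ 1) (sym weight-allExponents)) (weight-downFrom (suc k))

  M<2^[k+1] : M < 2 ^ suc k
  M<2^[k+1] = subst (M <_) M+1≡2^[k+1] (m<m+n M (s≤s z≤n))

  4∣M+1 : 1 ≤ k → 4 ∣ M + 1
  4∣M+1 k≥1 = subst (4 ∣_) (sym M+1≡2^[k+1]) (pow-∣ (s≤s k≥1))

  σ-formula : σ n ≡ M * ((1 + p) * (1 + q))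
  σ-formula = begin
    σ n
      ≡⟨ σ-enumeration allDivisors 0<n (blocks-unique R! R! R! R!) allDivisors-complete allDivisors-sound ⟩
    sum allDivisors
      ≡⟨ sum-assemble (blocks exponents≤k exponents≤k exponents≤k exponents≤k) ⟩
    1 * W + (p * W + (q * W + (p * q * W + 0)))
      ≡⟨ factor W p q ⟩
    W * ((1 + p) * (1 + q))
      ≡⟨ cong (_* ((1 + p) * (1 + q))) weight-allExponents ⟩
    M * ((1 + p) * (1 + q)) ∎
    where
    open ≡-Reasoning
    W : ℕ
    W = weight exponents≤k
    R! : Unique exponents≤k
    R! = proj₁ (downFrom-below (suc k))
    0<n : 0 < n
    0<n = >-nonZero⁻¹ n {{m*n≢0 (2 ^ k * p) q {{m*n≢0 (2 ^ k) p}}}}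
    factor : ∀ W p q → 1 * W + (p * W + (q * W + (p * q * W + 0))) ≡ W * ((1 + p) * (1 + q))
    factor = solve-∀

  lowBlock : ∀ {c es} → c ∣ p * q → c < p * q → All (_< suc k) es →
             All (λ i → c * 2 ^ i ∣ n × c * 2 ^ i < n) es
  lowBlock {c} c∣pq c<pq = All.map λ {i} i<k+1 → let i≤k = s≤s⁻¹ i<k+1 in
    oddPart-∣ c∣pq i≤k ,
    (begin-strict
      c * 2 ^ i     ≤⟨ *-monoʳ-≤ c (^-monoʳ-≤ 2 i≤k) ⟩
      c * 2 ^ k     <⟨ *-monoˡ-< (2 ^ k) c<pq ⟩
      p * q * 2 ^ k ≡⟨ n≡pq2^k ⟨
      n             ∎)
    where open ≤-Reasoning

  topBlock : ∀ {es} → All (_< k) es → All (λ i → p * q * 2 ^ i ∣ n × p * q * 2 ^ i < n) es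
  topBlock = All.map λ {i} i<k →
    oddPart-∣ ∣-refl (<⇒≤ i<k) ,
    (begin-strict
      p * q * 2 ^ i <⟨ *-monoʳ-< (p * q) {{m*n≢0 p q}} (^-monoʳ-< 2 (s≤s (s≤s z≤n)) i<k) ⟩
      p * q * 2 ^ k ≡⟨ n≡pq2^k ⟨
      n             ∎)
    where open ≤-Reasoning

  subsetSum-of-blocks : ∀ {e₁ e₂ e₃ e₄} → Below (suc k) e₁ → Below (suc k) e₂ → Below (suc k) e₃ →
                        Below k e₄ → sum (assemble (blocks e₁ e₂ e₃ e₄)) ≡ n →
                        ∃ λ S → S ⊆ aliquotParts n × sum S ≡ n
  subsetSum-of-blocks (e₁! , e₁<) (e₂! , e₂<) (e₃! , e₃<) (e₄! , e₄<) =
    subsetSum-of-distinctParts _ (blocks-unique e₁! e₂! e₃! e₄!)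
      (All-assemble (blocks _ _ _ _)
        ( lowBlock (1∣ _) (<-trans 1<p p<pq) e₁<
        ∷ lowBlock (m∣m*n {p} q) p<pq e₂<
        ∷ lowBlock (n∣m*n p) q<pq e₃<
        ∷ topBlock e₄< ∷ []))

  a : ℕ
  a = σ n ∸ 2 * n

  excess : abundant n → a + p * q ≡ M * (1 + p + q)
  excess abundant-n =
    excess-identity a M (2 ^ k) p q M+1≡2^[k+1] (trans (m∸n+n≡m (<⇒≤ abundant-n)) σ-formula)

  -- A weird n has abundance above M: otherwise fill-lowExcess writes n as a
  -- sum of distinct proper divisors.
  weird⇒M<a : weird n → M < a
  weird⇒M<a (abundant-n , ¬pseudoperfect) = ≰⇒> λ a≤M →
    ¬pseudoperfect (abundant-n , subsetSum-of-blocks (bits-below (suc k) (M ∸ a))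
      (downFrom-below (suc k)) (downFrom-below (suc k)) (downFrom-below k) (sum≡n a≤M))
    where
    open ≡-Reasoning
    V : ℕ
    V = weight exponents<k
    exponentBlocks : List Block
    exponentBlocks = blocks (bits (suc k) (M ∸ a)) exponents≤k exponents≤k exponents<k
    sum≡n : a ≤ M → sum (assemble exponentBlocks) ≡ n
    sum≡n a≤M = begin
      sum (assemble exponentBlocks) ≡⟨ sum-assemble exponentBlocks ⟩
      1 * weight (bits (suc k) (M ∸ a)) + (p * weight exponents≤k + (q * weight exponents≤k + (p * q * V + 0)))
        ≡⟨ cong₂ (λ x y → 1 * x + (p * y + (q * y + (p * q * V + 0))))
                 (weight-bits (suc k) (M ∸ a) (≤-<-trans (m∸n≤m M a) M<2^[k+1])) weight-allExponents ⟩
      1 * (M ∸ a) + (p * M + (q * M + (p * q * V + 0)))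
        ≡⟨ fill-lowExcess a M V p q a≤M (excess abundant-n) ⟩
      (V + 1) * p * q
        ≡⟨ cong (λ x → x * p * q) (weight-downFrom k) ⟩
      n ∎

  -- A weird n has p > M: otherwise fill-smallPrime writes n as a sum of
  -- distinct proper divisors.
  weird⇒M<p : weird n → M < p
  weird⇒M<p (abundant-n , ¬pseudoperfect) = ≰⇒> λ p≤M →
    ¬pseudoperfect (abundant-n , subsetSum-of-blocks ([] , []) ([] , []) (bits-below (suc k) p)
      (downFrom-below k) (sum≡n p≤M))
    where
    open ≡-Reasoning
    V : ℕ
    V = weight exponents<k
    exponentBlocks : List Block
    exponentBlocks = blocks [] [] (bits (suc k) p) exponents<k
    sum≡n : p ≤ M → sum (assemble exponentBlocks) ≡ n
    sum≡n p≤M = begin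
      sum (assemble exponentBlocks) ≡⟨ sum-assemble exponentBlocks ⟩
      1 * 0 + (p * 0 + (q * weight (bits (suc k) p) + (p * q * V + 0)))
        ≡⟨ cong (λ x → 1 * 0 + (p * 0 + (q * x + (p * q * V + 0))))
                (weight-bits (suc k) p (≤-<-trans p≤M M<2^[k+1])) ⟩
      1 * 0 + (p * 0 + (q * p + (p * q * V + 0)))
        ≡⟨ fill-smallPrime p q V ⟩
      (V + 1) * p * q
        ≡⟨ cong (λ x → x * p * q) (weight-downFrom k) ⟩
      n ∎

mainTheorem1 : (k p q : ℕ) → k ≥ 1 → Prime p → Prime q → ¬ (2 ∣ p) → ¬ (2 ∣ q) → p < q →
    weird (2 ^ k * p * q) →
    let n = 2 ^ k * p * q
        M = 2 ^ (k + 1) ∸ 1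
        a = σ n ∸ 2 * n
    in (a > M) × (M < p) × (p < 2 * M) × (4 ∣ a) × (M < a) × (a < M * (M + 1))
mainTheorem1 k p q k≥1 p-prime q-prime p-odd q-odd p<q weird-n@(abundant-n , _) =
  M<a , M<p , p<2M a M (≤-<-trans z≤n M<a) p<q key , 4∣a a M (4∣M+1 k≥1) p-odd q-odd key ,
  M<a , a<M[M+1] a M M<p (<-trans M<p p<q) key
  where
  open TwoPowerTimesPrimes k p-prime q-prime p-odd q-odd p<q
  key : a + p * q ≡ M * (1 + p + q)
  key = excess abundant-n
  M<a : M < a
  M<a = weird⇒M<a weird-n
  M<p : M < p
  M<p = weird⇒M<p weird-n
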